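{- For every integer $r > 1$, $m(r) \geq 2^r + 2$.
   Context: For a positive integer $n$, the unitary Cayley graph $X_n = \mathrm{Cay}(\mathbb{Z}_n, U_n)$ has vertex set $\mathbb{Z}_n$, and $x,y$ are adjacent iff $x - y \in U_n$, the group of units of $\mathbb{Z}_n$. An induced cycle of length $k \geq 3$ is a sequence of $k$ distinct vertices $v_0, \dots, v_{k-1}$ such that $v_i$ and $v_j$ are adjacent if and only if $i - j \equiv \pm 1 \pmod k$. $M(n)$ denotes the length of the longest induced cycle in $X_n$, and $m(r) = \max_n M(n)$ over all $n$ with exactly $r$ distinct prime divisors. -}

module Defs where

open import Data.Nat using (ℕ; suc; _<_; _≤_; _+_; _∸_; _%_; _^_; NonZero; s≤s)
open import Data.Nat.Divisibility using (_∣_)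
open import Data.Nat.Coprimality using (Coprime)
open import Data.Nat.Primality using (Prime)
open import Data.Fin using (Fin; toℕ)
open import Data.List using (List; length)
open import Data.List.Membership.Propositional using (_∈_)
open import Data.List.Relation.Unary.Unique.Propositional using (Unique)
open import Data.Product using (Σ; _×_)
open import Data.Sum using (_⊎_)
open import Function.Bundles using (_⇔_)
open import Function.Definitions using (Injective)
open import Relation.Binary.PropositionalEquality using (_≡_)

-- u is a unit of ℤ_n (u represented by its residue 0 ≤ u < n)
IsUnit : (n : ℕ) → ℕ → Set
IsUnit n u = Coprime u n

-- adjacency in the unitary Cayley graph X_n = Cay(ℤ_n, U_n):
-- x ~ y  iff  (x - y mod n) ∈ U_n
Adj : (n : ℕ) .{{_ : NonZero n}} → Fin n → Fin n → Set
Adj n x y = IsUnit n ((toℕ x + (n ∸ toℕ y)) % n)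

CycNbr : (k : ℕ) .{{_ : NonZero k}} → Fin k → Fin k → Set
CycNbr k i j = (toℕ j ≡ suc (toℕ i) % k) ⊎ (toℕ i ≡ suc (toℕ j) % k)

≥3⇒NonZero : ∀ {k} → 3 ≤ k → NonZero k
≥3⇒NonZero (s≤s _) = _

record InducedCycle (n : ℕ) .{{_ : NonZero n}} (k : ℕ) : Set where
  field
    k≥3       : 3 ≤ k
    vertex    : Fin k → Fin n
    distinct  : Injective _≡_ _≡_ vertex
    induced   : ∀ i j → Adj n (vertex i) (vertex j) ⇔ CycNbr k {{≥3⇒NonZero k≥3}} i j

HasPrimeDivisorCount : ℕ → ℕ → Set
HasPrimeDivisorCount n r =
  Σ (List ℕ) λ ps → length ps ≡ r × Unique ps × (∀ p → (p ∈ ps) ⇔ (Prime p × p ∣ n))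

module Submission where

-- For a prime q with 2N < q, the Chinese remainder theorem identifies X_{Nq} with the
-- tensor product of X_N and the complete graph X_q.  Representing a vertex of X_{Nq} as
-- x q + c N with x < N and a colour c ∈ {0,1,2}, two such vertices are adjacent iff their
-- x-parts are adjacent in X_N and their colours differ.  Fold the cycle C_{2l} onto the path
-- 0,1,…,l of C_{l+1} (up one side, back down the other) and colour the turning points 0 and l
-- with 2 and the rest alternately 0/1, in opposite phase on the two sides.  Then t ~ t′ in
-- C_{2l} iff their folds are adjacent in C_{l+1} and their colours differ, so an induced
-- C_{l+1} in X_N lifts to an induced C_{2l} in X_{Nq}.  Starting from the closed walk
-- 0,1,0,1 in X_2 and doubling r − 1 times gives length 2^r + 2 on r primes; once the length
-- is at least 5 the neighbourhood pattern of a cycle forces the vertices to be distinct.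

open import Defs
open import Data.Nat
open import Data.Nat.Properties
open import Data.Nat.Divisibility
open import Data.Nat.Coprimality using (Coprime; coprime-divisor; prime⇒coprime)
open import Data.Nat.Primality
open import Data.Nat.Primality.Factorisation using (factorise)
open import Data.Nat.DivMod using (m≡m%n+[m/n]*n; [m+kn]%n≡m%n; m<n⇒m%n≡m; n%n≡0; m%n<n)
open import Data.Nat.Tactic.RingSolver using (solve-∀)
open import Data.Fin using (Fin; toℕ; fromℕ<)
open import Data.Fin.Properties using (toℕ<n; toℕ-fromℕ<; toℕ-injective)
open import Data.List using ([]; _∷_)
open import Data.List.Membership.Propositional using (_∈_)
open import Data.List.Relation.Unary.Any using (here; there)
open import Data.List.Relation.Unary.All as All using ([]; _∷_)
open import Data.List.Relation.Unary.AllPairs using ([]; _∷_)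
open import Data.Product using (Σ; ∃; _×_; _,_; proj₂; map; map₂)
open import Data.Product.Function.NonDependent.Propositional using (_×-⇔_)
open import Data.Sum using (_⊎_; inj₁; inj₂; [_,_]; swap)
open import Data.Sum.Function.Propositional using (_⊎-⇔_)
open import Function.Base using (_∘_)
open import Function.Bundles using (_⇔_; mk⇔; Equivalence)
open import Function.Properties.Equivalence using ()
  renaming (refl to ⇔-refl; sym to ⇔-sym; trans to ⇔-trans)
open import Function.Related.TypeIsomorphisms using (¬-cong-⇔)
open import Relation.Nullary using (¬_; contradiction; yes; no)
open import Relation.Binary.PropositionalEquality
  using (_≡_; _≢_; refl; sym; trans; cong; cong₂; subst; subst₂; ≢-sym; module ≡-Reasoning)

open Equivalence using (to; from)

-- Coprimality, divisibility and primes

coprime-*⇔ : ∀ {z m n} → Coprime z (m * n) ⇔ (Coprime z m × Coprime z n)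
coprime-*⇔ {z} {m} {n} = mk⇔
  (λ c → (λ {_} (i∣z , i∣m) → c (i∣z , ∣m⇒∣m*n n i∣m))
       , (λ {_} (i∣z , i∣n) → c (i∣z , ∣n⇒∣m*n m i∣n)))
  (λ (cm , cn) {_} (i∣z , i∣mn) →
    cn (i∣z , coprime-divisor (λ {_} (j∣i , j∣m) → cm (∣-trans j∣i i∣z , j∣m)) i∣mn))

coprime-prime⇔∤ : ∀ {z p} → Prime p → Coprime z p ⇔ (¬ p ∣ z)
coprime-prime⇔∤ {z} {p} pp = mk⇔
  (λ c p∣z → nonTrivial⇒≢1 {{prime⇒nonTrivial pp}} (c (p∣z , ∣-refl)))
  from′
  where
  from′ : ¬ p ∣ z → Coprime z p
  from′ p∤z {_} (i∣z , i∣p) with prime⇒irreducible pp i∣p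
  ... | inj₁ i≡1 = i≡1
  ... | inj₂ refl = contradiction i∣z p∤z

∣-+-multiples : ∀ {x y} a b {N d} → x + a * N ≡ y + b * N → d ∣ N → d ∣ x → d ∣ y
∣-+-multiples {x} {y} a b {N} {d} e d∣N d∣x = ∣m+n∣m⇒∣n
  (subst (d ∣_) (trans e (+-comm y (b * N))) (∣m∣n⇒∣m+n d∣x (∣n⇒∣m*n a d∣N)))
  (∣n⇒∣m*n b d∣N)

coprime-+-multiples : ∀ {x y} a b {N} → x + a * N ≡ y + b * N → Coprime x N ⇔ Coprime y N
coprime-+-multiples a b e = mk⇔
  (λ c {_} (d∣y , d∣N) → c (∣-+-multiples b a (sym e) d∣N d∣y , d∣N))
  (λ c {_} (d∣x , d∣N) → c (∣-+-multiples a b e d∣N d∣x , d∣N))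

coprime-%⇔ : ∀ z N .{{_ : NonZero N}} → Coprime (z % N) N ⇔ Coprime z N
coprime-%⇔ z N =
  coprime-+-multiples (z / N) 0 (trans (sym (m≡m%n+[m/n]*n z N)) (sym (+-identityʳ z)))

coprime-*-cancelʳ : ∀ {w p N} → Coprime p N → Coprime (w * p) N ⇔ Coprime w N
coprime-*-cancelʳ {w} {p} {N} p⊥N = mk⇔
  (λ c {_} (i∣w , i∣N) → c (∣m⇒∣m*n p i∣w , i∣N))
  (λ c {i} (i∣wp , i∣N) → c (coprime-divisor (i⊥p i∣N) (subst (i ∣_) (*-comm w p) i∣wp) , i∣N))
  where
  i⊥p : ∀ {i} → i ∣ N → Coprime i p
  i⊥p i∣N {_} (j∣i , j∣p) = p⊥N (j∣p , ∣-trans j∣i i∣N)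

prime∣prime⇒≡ : ∀ {p q} → Prime p → Prime q → p ∣ q → p ≡ q
prime∣prime⇒≡ pp pq p∣q with prime⇒irreducible pq p∣q
... | inj₁ refl = contradiction pp ¬prime[1]
... | inj₂ p≡q  = p≡q

m≤n⇒m∣n! : ∀ {m n} → .{{NonZero m}} → m ≤ n → m ∣ n !
m≤n⇒m∣n! {suc m} m≤n = ∣-trans (m∣m*n (m !)) (m≤n⇒m!∣n! m≤n)

∃-prime> : ∀ m → ∃ λ p → Prime p × m < p
∃-prime> m with factorise (m ! + 1) {{>-nonZero (m≤n+m 1 (m !))}}
... | record { factors = [] ; isFactorisation = m!+1≡1 } =
  contradiction (+-cancelʳ-≡ 1 (m !) 0 m!+1≡1) (≢-nonZero⁻¹ (m !) {{m !≢0}})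
... | record { factors = p ∷ _ ; isFactorisation = eq ; factorsPrime = pp ∷ _ } =
  p , pp , ≰⇒> p≰m
  where
  p∣m!+1 : p ∣ m ! + 1
  p∣m!+1 = subst (p ∣_) (sym eq) (m∣m*n _)
  p≰m : ¬ p ≤ m
  p≰m p≤m = ¬prime[1]
    (subst Prime (∣1⇒≡1 (∣m+n∣m⇒∣n p∣m!+1 (m≤n⇒m∣n! {{prime⇒nonZero pp}} p≤m))) pp)

m<n⇒[m+kn]%n≡m : ∀ {m q} .{{_ : NonZero q}} k → m < q → (m + k * q) % q ≡ m
m<n⇒[m+kn]%n≡m {m} {q} k m<q = trans ([m+kn]%n≡m%n m k q) (m<n⇒m%n≡m m<q)

-- The hypothesis says z ≡ (c − c′) N modulo q, where c N and c′ N are already reduced.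
∣⇔≡-offset : ∀ {q N z a b c c′} .{{_ : NonZero q}} .{{_ : NonZero N}} →
  c * N < q → c′ * N < q → z + a * q + c′ * N ≡ b * q + c * N → q ∣ z ⇔ c ≡ c′
∣⇔≡-offset {q} {N} {z} {a} {b} {c} {c′} cN<q c′N<q e = mk⇔ to′ from′
  where
  from′ : c ≡ c′ → q ∣ z
  from′ refl = ∣m+n∣m⇒∣n (subst (q ∣_) (trans (sym z+aq≡bq) (+-comm z (a * q))) (n∣m*n b)) (n∣m*n a)
    where
    z+aq≡bq : z + a * q ≡ b * q
    z+aq≡bq = +-cancelʳ-≡ (c * N) _ _ e
  to′ : q ∣ z → c ≡ c′
  to′ (divides k refl) = *-cancelʳ-≡ c c′ N (begin
    c * N                        ≡⟨ m<n⇒[m+kn]%n≡m b cN<q ⟨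
    (c * N + b * q) % q          ≡⟨ cong (_% q) (+-comm (c * N) (b * q)) ⟩
    (b * q + c * N) % q          ≡⟨ cong (_% q) e ⟨
    (k * q + a * q + c′ * N) % q ≡⟨ cong (_% q) (regroup k a q (c′ * N)) ⟩
    (c′ * N + (k + a) * q) % q   ≡⟨ m<n⇒[m+kn]%n≡m (k + a) c′N<q ⟩
    c′ * N                       ∎)
    where
    open ≡-Reasoning
    regroup : ∀ k a q m → k * q + a * q + m ≡ m + (k + a) * q
    regroup = solve-∀

-- Adjacency in unitary Cayley graphs

mixed-radix-< : ∀ {N q x c} → x < N → c * N < q → x * q + c * N < N * q
mixed-radix-< {N} {q} {x} {c} x<N cN<q = begin-strict
  x * q + c * N <⟨ +-monoʳ-< (x * q) cN<q ⟩
  x * q + q     ≡⟨ +-comm (x * q) q ⟩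
  suc x * q     ≤⟨ *-monoˡ-≤ q x<N ⟩
  N * q         ∎
  where open ≤-Reasoning

-- For residues x, y < N, the number x + (N ∸ y) represents x − y modulo N.
DiffUnit : ℕ → ℕ → ℕ → Set
DiffUnit N x y = Coprime (x + (N ∸ y)) N

diffUnit-prime⇔≢ : ∀ {p x y} → Prime p → x < p → y < p → DiffUnit p x y ⇔ x ≢ y
diffUnit-prime⇔≢ {p} {x} {y} pp x<p y<p = ⇔-trans (coprime-prime⇔∤ pp) (¬-cong-⇔
  (∣⇔≡-offset {a = 0} {b = 1} {{prime⇒nonZero pp}}
    (subst (_< p) (sym (*-identityʳ x)) x<p) (subst (_< p) (sym (*-identityʳ y)) y<p) residue))
  where
  open ≡-Reasoning
  residue : x + (p ∸ y) + 0 * p + y * 1 ≡ 1 * p + x * 1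
  residue = begin
    x + (p ∸ y) + 0 + y * 1 ≡⟨ cong₂ _+_ (+-identityʳ _) (*-identityʳ y) ⟩
    x + (p ∸ y) + y         ≡⟨ +-assoc x (p ∸ y) y ⟩
    x + (p ∸ y + y)         ≡⟨ cong (x +_) (m∸n+n≡m (<⇒≤ y<p)) ⟩
    x + p                   ≡⟨ +-comm x p ⟩
    p + x                   ≡⟨ cong₂ _+_ (+-identityʳ p) (*-identityʳ x) ⟨
    1 * p + x * 1           ∎

diffUnit-lift : ∀ {N q x x′ c c′} .{{_ : NonZero N}} → Prime q → N < q →
  x < N → x′ < N → c * N < q → c′ * N < q →
  DiffUnit (N * q) (x * q + c * N) (x′ * q + c′ * N) ⇔ (DiffUnit N x x′ × c ≢ c′)
diffUnit-lift {N} {q} {x} {x′} {c} {c′} pq N<q x<N x′<N cN<q c′N<q =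
  ⇔-trans coprime-*⇔ (⇔-trans
    (coprime-+-multiples c′ c residue-mod-N ×-⇔ coprime-prime⇔∤ pq)
    (coprime-*-cancelʳ (prime⇒coprime pq N<q) ×-⇔ ¬-cong-⇔ q∣z⇔c≡c′))
  where
  X X′ z w : ℕ
  X = x * q + c * N
  X′ = x′ * q + c′ * N
  z = X + (N * q ∸ X′)
  w = x + (N ∸ x′)
  residue-mod-q : z + x′ * q + c′ * N ≡ (x + N) * q + c * N
  residue-mod-q = begin
    z + x′ * q + c′ * N   ≡⟨ +-assoc z (x′ * q) (c′ * N) ⟩
    X + (N * q ∸ X′) + X′ ≡⟨ +-assoc X _ X′ ⟩
    X + (N * q ∸ X′ + X′) ≡⟨ cong (X +_) (m∸n+n≡m (<⇒≤ (mixed-radix-< {c = c′} x′<N c′N<q))) ⟩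
    x * q + c * N + N * q ≡⟨ regroup x q c N ⟩
    (x + N) * q + c * N   ∎
    where
    open ≡-Reasoning
    regroup : ∀ x q c N → x * q + c * N + N * q ≡ (x + N) * q + c * N
    regroup = solve-∀
  q∣z⇔c≡c′ : q ∣ z ⇔ c ≡ c′
  q∣z⇔c≡c′ = ∣⇔≡-offset {a = x′} {b = x + N} {{prime⇒nonZero pq}} cN<q c′N<q residue-mod-q
  residue-mod-N : z + c′ * N ≡ w * q + c * N
  residue-mod-N = +-cancelʳ-≡ (x′ * q) _ _ (begin
    z + c′ * N + x′ * q             ≡⟨ exchange z (c′ * N) (x′ * q) ⟩
    z + x′ * q + c′ * N             ≡⟨ residue-mod-q ⟩
    (x + N) * q + c * N             ≡⟨ cong (λ m → (x + m) * q + c * N) (m∸n+n≡m (<⇒≤ x′<N)) ⟨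
    (x + (N ∸ x′ + x′)) * q + c * N ≡⟨ cong (λ m → m * q + c * N) (+-assoc x (N ∸ x′) x′) ⟨
    (w + x′) * q + c * N            ≡⟨ distrib w x′ q (c * N) ⟩
    w * q + c * N + x′ * q          ∎)
    where
    open ≡-Reasoning
    exchange : ∀ a b d → a + b + d ≡ a + d + b
    exchange = solve-∀
    distrib : ∀ w x q m → (w + x) * q + m ≡ w * q + m + x * q
    distrib = solve-∀

-- Cycles

data CyclicSucc (k : ℕ) : ℕ → ℕ → Set where
  next : ∀ {s} → suc s < k → CyclicSucc k s (suc s)
  wrap : ∀ {s} → suc s ≡ k → CyclicSucc k s 0

CycleEdge : ℕ → ℕ → ℕ → Set
CycleEdge k s t = CyclicSucc k s t ⊎ CyclicSucc k t s

cyclicSucc⇔≡suc% : ∀ {k s t} .{{_ : NonZero k}} → s < k → CyclicSucc k s t ⇔ (t ≡ suc s % k)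
cyclicSucc⇔≡suc% {k} {s} {t} s<k = mk⇔ to′ from′
  where
  to′ : CyclicSucc k s t → t ≡ suc s % k
  to′ (next 1+s<k) = sym (m<n⇒m%n≡m 1+s<k)
  to′ (wrap refl)  = sym (n%n≡0 (suc s))
  from′ : t ≡ suc s % k → CyclicSucc k s t
  from′ refl with m≤n⇒m<n∨m≡n s<k
  ... | inj₁ 1+s<k = subst (CyclicSucc k s) (sym (m<n⇒m%n≡m 1+s<k)) (next 1+s<k)
  ... | inj₂ refl  = subst (CyclicSucc k s) (sym (n%n≡0 (suc s))) (wrap refl)

cycleEdge⇔cycNbr : ∀ {k} .{{_ : NonZero k}} (i j : Fin k) →
  CycleEdge k (toℕ i) (toℕ j) ⇔ CycNbr k i j
cycleEdge⇔cycNbr i j = cyclicSucc⇔≡suc% (toℕ<n i) ⊎-⇔ cyclicSucc⇔≡suc% (toℕ<n j)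

cyclicSucc-injective : ∀ {k s s′ t} → CyclicSucc k s t → CyclicSucc k s′ t → s ≡ s′
cyclicSucc-injective (next _) (next _)  = refl
cyclicSucc-injective (wrap e) (wrap e′) = suc-injective (trans e (sym e′))

cyclicSucc-functional : ∀ {k s t t′} → CyclicSucc k s t → CyclicSucc k s t′ → t ≡ t′
cyclicSucc-functional (next _)     (next _)     = refl
cyclicSucc-functional (wrap _)     (wrap _)     = refl
cyclicSucc-functional (next 1+s<k) (wrap refl)  = contradiction 1+s<k (<-irrefl refl)
cyclicSucc-functional (wrap refl)  (next 1+s<k) = contradiction 1+s<k (<-irrefl refl)

cyclicSucc-exists : ∀ {k s} → s < k → ∃ λ t → t < k × CyclicSucc k s t
cyclicSucc-exists {k} {s} s<k with m≤n⇒m<n∨m≡n s<k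
... | inj₁ 1+s<k = suc s , 1+s<k , next 1+s<k
... | inj₂ refl  = 0 , s≤s z≤n , wrap refl

cyclicPred-exists : ∀ {k t} → t < k → ∃ λ s → s < k × CyclicSucc k s t
cyclicPred-exists {suc k} {zero}  _   = k , ≤-refl , wrap refl
cyclicPred-exists {suc k} {suc t} t<k = t , <-trans (n<1+n t) t<k , next t<k

cyclicSucc-+ : ∀ {k s t} → CyclicSucc k s t → ∃ λ w → t + w * k ≡ suc s
cyclicSucc-+ {s = s} (next _)    = 0 , +-identityʳ (suc s)
cyclicSucc-+ {k}     (wrap refl) = 1 , +-identityʳ k

-- Four steps, each adding 1 up to a multiple of k, return to the start only if w k = 4.
closed-walk-4⇒≤4 : ∀ {k a b c d} →
  CyclicSucc k a b → CyclicSucc k b c → CyclicSucc k c d → CyclicSucc k d a → k ≤ 4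
closed-walk-4⇒≤4 {k} {a} {b} {c} {d} ab bc cd da
  with cyclicSucc-+ ab | cyclicSucc-+ bc | cyclicSucc-+ cd | cyclicSucc-+ da
... | w₁ , e₁ | w₂ , e₂ | w₃ , e₃ | w₄ , e₄ =
  w*k≡4⇒k≤4 (w₁ + w₂ + w₃ + w₄) (+-cancelˡ-≡ (a + b + c + d) _ _ (begin
    a + b + c + d + (w₁ + w₂ + w₃ + w₄) * k                   ≡⟨ regroup a b c d w₁ w₂ w₃ w₄ k ⟩
    (b + w₁ * k) + (c + w₂ * k) + (d + w₃ * k) + (a + w₄ * k) ≡⟨ cong₂ _+_ (cong₂ _+_ (cong₂ _+_ e₁ e₂) e₃) e₄ ⟩
    suc a + suc b + suc c + suc d                             ≡⟨ count a b c d ⟩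
    a + b + c + d + 4                                         ∎))
  where
  open ≡-Reasoning
  regroup : ∀ a b c d w₁ w₂ w₃ w₄ k → a + b + c + d + (w₁ + w₂ + w₃ + w₄) * k
          ≡ (b + w₁ * k) + (c + w₂ * k) + (d + w₃ * k) + (a + w₄ * k)
  regroup = solve-∀
  count : ∀ a b c d → suc a + suc b + suc c + suc d ≡ a + b + c + d + 4
  count = solve-∀
  w*k≡4⇒k≤4 : ∀ w → w * k ≡ 4 → k ≤ 4
  w*k≡4⇒k≤4 zero    ()
  w*k≡4⇒k≤4 (suc w) e = subst (k ≤_) e (m≤m+n k (w * k))

neighbours-determine-vertex : ∀ {k s t} → 5 ≤ k → s < k → t < k →
  (∀ {u} → u < k → CycleEdge k s u → CycleEdge k t u) → s ≡ t
neighbours-determine-vertex {k} {s} {t} 5≤k s<k t<k sameNbrs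
  with cyclicSucc-exists s<k | cyclicPred-exists s<k
... | u₁ , u₁<k , s→u₁ | u₀ , u₀<k , u₀→s
  with sameNbrs u₁<k (inj₁ s→u₁) | sameNbrs u₀<k (inj₂ u₀→s)
... | inj₁ t→u₁ | _         = cyclicSucc-injective s→u₁ t→u₁
... | _         | inj₂ u₀→t = cyclicSucc-functional u₀→s u₀→t
... | inj₂ u₁→t | inj₁ t→u₀ = contradiction (closed-walk-4⇒≤4 s→u₁ u₁→t t→u₀ u₀→s) (<⇒≱ 5≤k)

-- Cycle shapes and their lifting

-- A closed walk in X_N with exactly the adjacencies of the k-cycle; its vertices need not be
-- distinct (the walk 0,1,0,1 in X_2 is one), but they are once 5 ≤ k.
record CycleShape (N k : ℕ) : Set where
  field
    vertex    : ℕ → ℕ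
    vertex<   : ∀ s → vertex s < N
    unit⇔edge : ∀ {s t} → s < k → t < k → DiffUnit N (vertex s) (vertex t) ⇔ CycleEdge k s t

record ColouredFold (m k : ℕ) : Set where
  field
    fold     : ℕ → ℕ
    fold<    : ∀ {t} → t < k → fold t < m
    colour   : ℕ → ℕ
    colour≤2 : ∀ t → colour t ≤ 2
    edge⇔    : ∀ {t t′} → t < k → t′ < k →
               CycleEdge k t t′ ⇔ (CycleEdge m (fold t) (fold t′) × colour t ≢ colour t′)

lift : ∀ {N m k q} .{{_ : NonZero N}} → Prime q → N + N < q →
  CycleShape N m → ColouredFold m k → CycleShape (N * q) k
lift {N} {m} {k} {q} pq 2N<q S F = record
  { vertex    = λ t → vertex (fold t) * q + colour t * N
  ; vertex<   = λ t → mixed-radix-< {c = colour t} (vertex< (fold t)) (colour*N<q t)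
  ; unit⇔edge = λ t<k t′<k → ⇔-trans
      (diffUnit-lift pq N<q (vertex< _) (vertex< _) (colour*N<q _) (colour*N<q _))
      (⇔-trans (unit⇔edge (fold< t<k) (fold< t′<k) ×-⇔ ⇔-refl) (⇔-sym (edge⇔ t<k t′<k)))
  }
  where
  open CycleShape S
  open ColouredFold F
  N<q : N < q
  N<q = ≤-<-trans (m≤m+n N N) 2N<q
  colour*N<q : ∀ t → colour t * N < q
  colour*N<q t = ≤-<-trans (*-monoˡ-≤ N (colour≤2 t)) (subst (_< q) (cong (N +_) (sym (+-identityʳ N))) 2N<q)

inducedCycle : ∀ {N k} .{{_ : NonZero N}} → 5 ≤ k → CycleShape N k → InducedCycle N k
inducedCycle {N} {k} 5≤k S = record
  { k≥3      = 3≤k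
  ; vertex   = vertex′
  ; distinct = λ {i} {j} vi≡vj → toℕ-injective
      (neighbours-determine-vertex 5≤k (toℕ<n i) (toℕ<n j) λ {u} u<k i~u →
        to (unit⇔edge (toℕ<n j) u<k)
          (subst (λ v → DiffUnit N v (vertex u)) (same-vertex vi≡vj) (from (unit⇔edge (toℕ<n i) u<k) i~u)))
  ; induced  = λ i j → ⇔-trans (coprime-%⇔ _ N)
      (subst₂ (λ a b → DiffUnit N a b ⇔ CycNbr k i j) (sym (toℕ-vertex′ i)) (sym (toℕ-vertex′ j))
        (⇔-trans (unit⇔edge (toℕ<n i) (toℕ<n j)) (cycleEdge⇔cycNbr i j)))
  }
  where
  open CycleShape S
  3≤k : 3 ≤ k
  3≤k = ≤-trans (s≤s (s≤s (s≤s z≤n))) 5≤k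
  instance
    k≢0 : NonZero k
    k≢0 = ≥3⇒NonZero 3≤k
  vertex′ : Fin k → Fin N
  vertex′ i = fromℕ< (vertex< (toℕ i))
  toℕ-vertex′ : ∀ i → toℕ (vertex′ i) ≡ vertex (toℕ i)
  toℕ-vertex′ i = toℕ-fromℕ< (vertex< (toℕ i))
  same-vertex : ∀ {i j} → vertex′ i ≡ vertex′ j → vertex (toℕ i) ≡ vertex (toℕ j)
  same-vertex {i} {j} e = trans (sym (toℕ-vertex′ i)) (trans (cong toℕ e) (toℕ-vertex′ j))

-- Folding C_{2l} onto C_{l+1}

%2≤1 : ∀ n → n % 2 ≤ 1
%2≤1 n = ≤-pred (m%n<n n 2)

%2≢suc%2 : ∀ n → n % 2 ≢ suc n % 2
%2≢suc%2 zero          ()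
%2≢suc%2 (suc zero)    ()
%2≢suc%2 (suc (suc n)) = %2≢suc%2 n

%2≢2 : ∀ n → n % 2 ≢ 2
%2≢2 n e = contradiction (subst (_≤ 1) e (%2≤1 n)) λ { (s≤s ()) }

-- A point folded to a on the descending side gets the opposite parity (suc a) % 2, so that
-- a and l + l ∸ suc a, which lie over an edge of the path without being adjacent in C_{2l},
-- receive equal colours.
ascColour : ℕ → ℕ → ℕ
ascColour l zero = 2
ascColour l (suc a) with suc a ≟ l
... | yes _ = 2
... | no  _ = suc a % 2

ascColour≤2 : ∀ l a → ascColour l a ≤ 2
ascColour≤2 l zero = ≤-refl
ascColour≤2 l (suc a) with suc a ≟ l
... | yes _ = ≤-refl
... | no  _ = ≤-trans (%2≤1 (suc a)) (s≤s z≤n)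

ascColour-turn : ∀ l → ascColour l l ≡ 2
ascColour-turn zero = refl
ascColour-turn (suc l) with suc l ≟ suc l
... | yes _          = refl
... | no  1+l≢1+l    = contradiction refl 1+l≢1+l

ascColour-interior : ∀ {l a} → suc a ≢ l → ascColour l (suc a) ≡ suc a % 2
ascColour-interior {l} {a} 1+a≢l with suc a ≟ l
... | yes 1+a≡l = contradiction 1+a≡l 1+a≢l
... | no  _     = refl

ascColour-step : ∀ {l a} → 2 ≤ l → suc a ≤ l → ascColour l a ≢ ascColour l (suc a)
ascColour-step {l} {zero} 2≤l _ e = contradiction (trans e (ascColour-interior (<⇒≢ 2≤l))) λ ()
ascColour-step {l} {suc a} _ 2+a≤l with suc (suc a) ≟ l
... | yes _ = %2≢2 (suc a) ∘ trans (sym (ascColour-interior (<⇒≢ 2+a≤l)))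
... | no  _ = %2≢suc%2 (suc a) ∘ trans (sym (ascColour-interior (<⇒≢ 2+a≤l)))

data FoldView (l : ℕ) : ℕ → Set where
  asc     : ∀ {a} → a ≤ l → FoldView l a
  desc    : ∀ {a t} → 0 < a → a < l → a + t ≡ l + l → FoldView l t
  outside : ∀ {t} → l + l ≤ t → FoldView l t

foldView : ∀ l t → FoldView l t
foldView l t with t ≤? l | t <? l + l
... | yes t≤l | _        = asc t≤l
... | no  t≰l | yes t<2l = desc (m<n⇒0<n∸m t<2l) 2l∸t<l (m∸n+n≡m (<⇒≤ t<2l))
  where
  2l∸t<l : l + l ∸ t < l
  2l∸t<l = subst (l + l ∸ t <_) (m+n∸n≡m l l) (∸-monoʳ-< (≰⇒> t≰l) (<⇒≤ t<2l))
... | no  _   | no  t≮2l = outside (≮⇒≥ t≮2l)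

viewFold : ∀ {l t} → FoldView l t → ℕ
viewFold (asc {a} _)      = a
viewFold (desc {a} _ _ _) = a
viewFold (outside _)      = 0

viewColour : ∀ {l t} → FoldView l t → ℕ
viewColour {l} (asc {a} _)      = ascColour l a
viewColour     (desc {a} _ _ _) = suc a % 2
viewColour     (outside _)      = 0

viewFold< : ∀ {l t} (v : FoldView l t) → viewFold v < suc l
viewFold< (asc a≤l)      = s≤s a≤l
viewFold< (desc _ a<l _) = m<n⇒m<1+n a<l
viewFold< (outside _)    = s≤s z≤n

viewColour≤2 : ∀ {l t} (v : FoldView l t) → viewColour v ≤ 2
viewColour≤2 {l} (asc {a} _)      = ascColour≤2 l a
viewColour≤2     (desc {a} _ _ _) = ≤-trans (%2≤1 (suc a)) (s≤s z≤n)
viewColour≤2     (outside _)      = z≤n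

sum-tight : ∀ {a b c d} → a ≤ c → b ≤ d → a + b ≡ c + d → a ≡ c × b ≡ d
sum-tight {a} {b} {c} {d} a≤c b≤d e with m≤n⇒m<n∨m≡n a≤c
... | inj₁ a<c  = contradiction e (<⇒≢ (+-mono-<-≤ a<c b≤d))
... | inj₂ refl = refl , +-cancelˡ-≡ a b d e

fold-edge⇒ : ∀ {l t t′} → 2 ≤ l → (v : FoldView l t) (v′ : FoldView l t′) →
  CyclicSucc (l + l) t t′ → CycleEdge (suc l) (viewFold v) (viewFold v′) × viewColour v ≢ viewColour v′
fold-edge⇒ 2≤l (asc _) (asc 1+a≤l) (next _) = inj₁ (next (s≤s 1+a≤l)) , ascColour-step 2≤l 1+a≤l
fold-edge⇒ {l} 2≤l (asc a≤l) (desc {a′} _ a′<l e) (next _)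
  with sum-tight a′<l (s≤s a≤l) (trans (cong suc e) (sym (+-suc l l)))
... | refl , refl = inj₂ (next ≤-refl) , %2≢2 (suc a′) ∘ sym ∘ trans (sym (ascColour-turn (suc a′)))
fold-edge⇒ 2≤l (desc _ a<l e) (asc 1+t≤l) (next _) =
  contradiction e (<⇒≢ (+-mono-<-≤ a<l (≤-trans (n≤1+n _) 1+t≤l)))
fold-edge⇒ 2≤l (desc {a} {t} _ a<l e) (desc {a′} _ _ e′) (next _)
  with +-cancelʳ-≡ t a (suc a′) (trans e (trans (sym e′) (+-suc a′ t)))
... | refl = inj₂ (next (m<n⇒m<1+n a<l)) , %2≢suc%2 a′
fold-edge⇒ 2≤l (outside 2l≤t) _ (next 1+t<2l) = contradiction 2l≤t (<⇒≱ (<-trans (n<1+n _) 1+t<2l))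
fold-edge⇒ 2≤l _ (outside 2l≤1+t) (next 1+t<2l) = contradiction 2l≤1+t (<⇒≱ 1+t<2l)
fold-edge⇒ {l} 2≤l (asc t≤l) _ (wrap e) =
  contradiction e (<⇒≢ (≤-<-trans (s≤s t≤l) (subst (_< l + l) (+-comm l 1) (+-monoʳ-< l 2≤l))))
fold-edge⇒ 2≤l (desc {a} {t} _ _ e) (asc _) (wrap e′)
  with +-cancelʳ-≡ t a 1 (trans e (sym e′))
... | refl = inj₂ (next (s≤s (<⇒≤ 2≤l))) , λ ()
fold-edge⇒ 2≤l _ (desc _ a′<l e′) (wrap _) = contradiction e′ (<⇒≢ (+-mono-<-≤ a′<l z≤n))
fold-edge⇒ {l} 2≤l _ (outside 2l≤0) (wrap _) = contradiction (≤-trans (≤-trans 2≤l (m≤m+n l l)) 2l≤0) λ ()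
fold-edge⇒ 2≤l (outside 2l≤t) _ (wrap e) = contradiction e (>⇒≢ (s≤s 2l≤t))

fold-edge⇐ : ∀ {l t t′} (v : FoldView l t) (v′ : FoldView l t′) → t < l + l → t′ < l + l →
  CyclicSucc (suc l) (viewFold v) (viewFold v′) → viewColour v ≢ viewColour v′ → CycleEdge (l + l) t t′
fold-edge⇐ (outside 2l≤t) _ t<2l _ _ _ = contradiction 2l≤t (<⇒≱ t<2l)
fold-edge⇐ _ (outside 2l≤t′) _ t′<2l _ _ = contradiction 2l≤t′ (<⇒≱ t′<2l)
fold-edge⇐ (asc _) (asc _) _ t′<2l (next _) _ = inj₁ (next t′<2l)
fold-edge⇐ {l} (asc _) (asc _) _ _ (wrap refl) ≢ = contradiction (ascColour-turn l) ≢
fold-edge⇐ (asc {zero} _) (desc _ _ e) _ _ (next _) _ = inj₂ (wrap e)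
fold-edge⇐ (asc {suc a} _) (desc _ 2+a<l _) _ _ (next _) ≢ =
  contradiction (ascColour-interior (<⇒≢ (<-trans (n<1+n _) 2+a<l))) ≢
fold-edge⇐ (asc _) (desc () _ _) _ _ (wrap _) _
fold-edge⇐ {l} (desc {a} {t} _ _ e) (asc _) t<2l _ (next _) ≢ with suc a ≟ l
... | yes refl = inj₂ (subst (CyclicSucc (l + l) (suc a)) (sym t≡2+a) (next (subst (_< l + l) t≡2+a t<2l)))
  where
  t≡2+a : t ≡ suc (suc a)
  t≡2+a = +-cancelˡ-≡ a t (suc (suc a)) (trans e (sym (+-suc a (suc a))))
... | no  _    = contradiction refl ≢   -- both colours are suc a % 2
fold-edge⇐ (desc _ a<l _) (asc _) _ _ (wrap refl) _ = contradiction a<l (<-irrefl refl)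
fold-edge⇐ (desc {a} {t} _ _ e) (desc {t = t′} _ _ e′) t<2l _ (next _) _ =
  inj₂ (subst (CyclicSucc _ t′) (sym t≡1+t′) (next (subst (_< _) t≡1+t′ t<2l)))
  where
  t≡1+t′ : t ≡ suc t′
  t≡1+t′ = +-cancelˡ-≡ a t (suc t′) (trans e (trans (sym e′) (sym (+-suc a t′))))
fold-edge⇐ (desc _ _ _) (desc () _ _) _ _ (wrap _) _

doubling : ∀ {l} → 2 ≤ l → ColouredFold (suc l) (l + l)
doubling {l} 2≤l = record
  { fold     = λ t → viewFold (foldView l t)
  ; fold<    = λ {t} _ → viewFold< (foldView l t)
  ; colour   = λ t → viewColour (foldView l t)
  ; colour≤2 = λ t → viewColour≤2 (foldView l t)
  ; edge⇔    = λ {t} {t′} t<2l t′<2l → mk⇔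
      [ fold-edge⇒ 2≤l (foldView l t) (foldView l t′)
      , (λ s → map swap ≢-sym (fold-edge⇒ 2≤l (foldView l t′) (foldView l t) s)) ]
      (λ where
        (inj₁ s , ≢) → fold-edge⇐ (foldView l t) (foldView l t′) t<2l t′<2l s ≢
        (inj₂ s , ≢) → swap (fold-edge⇐ (foldView l t′) (foldView l t) t′<2l t<2l s (≢-sym ≢)))
  }

cycleEdge₄⇔%2≢ : ∀ {s t} → s < 4 → t < 4 → CycleEdge 4 s t ⇔ (s % 2 ≢ t % 2)
cycleEdge₄⇔%2≢ {s} {t} s<4 t<4 = mk⇔ to′ (from′ s t s<4 t<4)
  where
  succ-flips : ∀ {s t} → CyclicSucc 4 s t → s % 2 ≢ t % 2
  succ-flips {s} (next _)    = %2≢suc%2 s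
  succ-flips     (wrap refl) = λ ()
  to′ : CycleEdge 4 s t → s % 2 ≢ t % 2
  to′ (inj₁ s→t) = succ-flips s→t
  to′ (inj₂ t→s) = ≢-sym (succ-flips t→s)
  from′ : ∀ s t → s < 4 → t < 4 → s % 2 ≢ t % 2 → CycleEdge 4 s t
  from′ 0 1 _ _ _ = inj₁ (next (s≤s (s≤s z≤n)))
  from′ 1 2 _ _ _ = inj₁ (next (s≤s (s≤s (s≤s z≤n))))
  from′ 2 3 _ _ _ = inj₁ (next ≤-refl)
  from′ 3 0 _ _ _ = inj₁ (wrap refl)
  from′ 1 0 _ _ _ = inj₂ (next (s≤s (s≤s z≤n)))
  from′ 2 1 _ _ _ = inj₂ (next (s≤s (s≤s (s≤s z≤n))))
  from′ 3 2 _ _ _ = inj₂ (next ≤-refl)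
  from′ 0 3 _ _ _ = inj₂ (wrap refl)
  from′ 0 0 _ _ ≢ = contradiction refl ≢
  from′ 0 2 _ _ ≢ = contradiction refl ≢
  from′ 1 1 _ _ ≢ = contradiction refl ≢
  from′ 1 3 _ _ ≢ = contradiction refl ≢
  from′ 2 0 _ _ ≢ = contradiction refl ≢
  from′ 2 2 _ _ ≢ = contradiction refl ≢
  from′ 3 1 _ _ ≢ = contradiction refl ≢
  from′ 3 3 _ _ ≢ = contradiction refl ≢
  from′ (suc (suc (suc (suc _)))) _ (s≤s (s≤s (s≤s (s≤s ())))) _ _
  from′ _ (suc (suc (suc (suc _)))) _ (s≤s (s≤s (s≤s (s≤s ())))) _

alternating-square : CycleShape 2 4
alternating-square = record
  { vertex    = _% 2
  ; vertex<   = λ s → m%n<n s 2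
  ; unit⇔edge = λ {s} {t} s<4 t<4 →
      ⇔-trans (diffUnit-prime⇔≢ prime[2] (m%n<n s 2) (m%n<n t 2)) (⇔-sym (cycleEdge₄⇔%2≢ s<4 t<4))
  }

primeDivisorCount-prime : ∀ {p} → Prime p → HasPrimeDivisorCount p 1
primeDivisorCount-prime {p} pp = p ∷ [] , refl , [] ∷ [] , λ q → mk⇔
  (λ { (here refl) → pp , ∣-refl })
  (λ (pq , q∣p) → here (prime∣prime⇒≡ pq pp q∣p))

primeDivisorCount-* : ∀ {N q r} .{{_ : NonZero N}} → Prime q → N < q →
  HasPrimeDivisorCount N r → HasPrimeDivisorCount (N * q) (suc r)
primeDivisorCount-* {N} {q} pq N<q (ps , ∣ps∣≡r , unique , ps⇔) =
  q ∷ ps , cong suc ∣ps∣≡r , All.tabulate q≢ ∷ unique , λ p → mk⇔ (to′ p) (from′ p)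
  where
  q≢ : ∀ {p} → p ∈ ps → q ≢ p
  q≢ {p} p∈ps = >⇒≢ (≤-<-trans (∣⇒≤ (proj₂ (to (ps⇔ p) p∈ps))) N<q)
  to′ : ∀ p → p ∈ q ∷ ps → Prime p × p ∣ N * q
  to′ p (here refl)  = pq , n∣m*n N
  to′ p (there p∈ps) = map₂ (∣m⇒∣m*n q) (to (ps⇔ p) p∈ps)
  from′ : ∀ p → Prime p × p ∣ N * q → p ∈ q ∷ ps
  from′ p (pp , p∣Nq) with euclidsLemma N q pp p∣Nq
  ... | inj₁ p∣N = there (from (ps⇔ p) (pp , p∣N))
  ... | inj₂ p∣q = here (prime∣prime⇒≡ pp pq p∣q)

cycleShape-with-primes : ∀ r → Σ ℕ λ N → Σ (NonZero N) λ _ →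
  HasPrimeDivisorCount N (suc r) × CycleShape N (2 + 2 ^ suc r)
cycleShape-with-primes zero = 2 , _ , primeDivisorCount-prime prime[2] , alternating-square
cycleShape-with-primes (suc r) with cycleShape-with-primes r
... | N , N≢0 , count , S with ∃-prime> (N + N)
... | q , pq , 2N<q = N * q , m*n≢0 N q {{N≢0}} {{prime⇒nonZero pq}} ,
  primeDivisorCount-* {{N≢0}} pq (≤-<-trans (m≤m+n N N) 2N<q) count ,
  subst (CycleShape (N * q)) (double (2 ^ suc r))
    (lift {{N≢0}} pq 2N<q S (doubling (s≤s (m^n>0 2 (suc r)))))
  where
  double : ∀ x → suc x + suc x ≡ 2 + 2 * x
  double = solve-∀

theorem3p1 : (r : ℕ) → 1 < r →
    Σ ℕ λ n → Σ (NonZero n) λ nz → HasPrimeDivisorCount n r ×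
      Σ ℕ λ k → (2 ^ r + 2 ≤ k) × InducedCycle n {{nz}} k
theorem3p1 (suc zero) (s≤s ())
theorem3p1 (suc (suc r)) _ with cycleShape-with-primes (suc r)
... | N , N≢0 , count , S =
  N , N≢0 , count , 2 + 2 ^ suc (suc r) , ≤-reflexive (+-comm (2 ^ suc (suc r)) 2) ,
  inducedCycle {{N≢0}} 5≤k S
  where
  5≤k : 5 ≤ 2 + 2 ^ suc (suc r)
  5≤k = ≤-trans (n≤1+n 5) (+-monoʳ-≤ 2 (^-monoʳ-≤ 2 {2} {suc (suc r)} (s≤s (s≤s z≤n))))
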